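{- Let $t\ge1$, $G=\mathbb{Z}_{4t+2}$, and let $\psi=\gamma\prod_{j=1}^w\partial_{i_j}$ where $i_1,\ldots,i_w$ are distinct elements of $\{2,\ldots,4t+1\}$. If $\psi$ is quasi-orthogonal then $t\le w\le 3t+1$.
   Context: Index the elements $0,1,\ldots,4t+1$ of $G$ by $1,\ldots,4t+2$. $\gamma(j,k)=(-1)^{\lfloor (j+k)/(4t+2)\rfloor}$ for $j,k\in\{0,\ldots,4t+1\}$. For $2\le i\le 4t+2$, $\partial_i(x,y)=\delta_i(x)\delta_i(y)\delta_i(x+y)$ where $\delta_i:G\to\{\pm1\}$ is $-1$ at the element with index $i$ (i.e. $i-1$) and $1$ elsewhere. Products of cocycles are pointwise. For a normalized cocycle $\psi$ with matrix $M_\psi=[\psi(g,h)]$, $RE(M_\psi)=\sum_{g\ne0}|\sum_h\psi(g,h)|$; since $\psi$ here is not a coboundary, it is quasi-orthogonal iff $RE(M_\psi)=4t$. -}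

module Defs where

open import Data.Nat as ℕ using (ℕ; suc; _≡ᵇ_; _∸_)
open import Data.Nat.DivMod using (_/_; _%_)
open import Data.Integer as ℤ using (ℤ; ∣_∣)
open import Data.List using (List; map; foldr; upTo)
open import Data.Bool using (if_then_else_)
open import Relation.Binary.PropositionalEquality using (_≡_)

-- order of the cyclic group G = ℤ_{4t+2}; elements are 0,…,4t+1 (as ℕ, addition mod N t)
N : ℕ → ℕ
N t = suc (suc (4 ℕ.* t))

sumℤ : List ℤ → ℤ
sumℤ = foldr ℤ._+_ (ℤ.+ 0)

prodℤ : List ℤ → ℤ
prodℤ = foldr ℤ._*_ (ℤ.+ 1)

γ : ℕ → ℕ → ℕ → ℤ
γ t j k = ℤ.-1ℤ ℤ.^ ((j ℕ.+ k) / N t)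

-- δ_i(x) = -1 iff x is the element with index i, i.e. x = i - 1
δ : ℕ → ℕ → ℤ
δ i x = if x ≡ᵇ (i ∸ 1) then ℤ.-1ℤ else ℤ.+ 1

∂ : ℕ → ℕ → ℕ → ℕ → ℤ
∂ t i x y = δ i x ℤ.* δ i y ℤ.* δ i ((x ℕ.+ y) % N t)

ψ : ℕ → List ℕ → ℕ → ℕ → ℤ
ψ t is x y = γ t x y ℤ.* prodℤ (map (λ i → ∂ t i x y) is)

RE : ℕ → (ℕ → ℕ → ℤ) → ℕ
RE t f = foldr ℕ._+_ 0
  (map (λ g → ∣ sumℤ (map (λ h → f g h) (upTo (N t))) ∣) (map suc (upTo (suc (4 ℕ.* t)))))

-- quasi-orthogonality for the (non-coboundary) cocycles considered: RE(M_ψ) = 4t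
QuasiOrthogonal : ℕ → (ℕ → ℕ → ℤ) → Set
QuasiOrthogonal t f = RE t f ≡ 4 ℕ.* t

-- Write ψ = γ · ∂χ, where χ = ∏ δ_i is the ±1 function on G that is -1 exactly at the w
-- positions i - 1. Since uvw ≡ u + v + w - 2 (mod 4) for signs, the row sums of M_ψ satisfy
-- R_g ≡ 2 + 2g (mod 4); so each of the 2t even rows g = 2, 4, …, 4t has |R_g| ≥ 2, and
-- RE(M_ψ) = 4t forces R_1 = 0. As R_1 = χ(1) (Σ_{h ≤ 4t} χ(h) χ(h+1) - 1), the sign sequence
-- χ(0), …, χ(4t+1), which starts and ends with +1, changes sign exactly 2t times. Every sign
-- change involves a position of each sign, and a position lies in at most two changes (an
-- endpoint in one), whence 2t ≤ 2w and 2t + 2 ≤ 2(4t + 2 - w).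

module Submission where

open import Defs
open import Data.Nat using (ℕ; _≤_; _+_; _*_)
open import Data.Product using (_×_)
open import Data.List using (List; length)
open import Data.List.Relation.Unary.All using (All)
open import Data.List.Relation.Unary.Unique.Propositional using (Unique)

open import Data.Bool using (true; false; T)
open import Data.Empty using (⊥-elim)
open import Data.Integer
  using (ℤ; +_; -[1+_]; ∣_∣; -1ℤ)
  renaming (_+_ to _+ᶻ_; _-_ to _-ᶻ_; _*_ to _*ᶻ_; -_ to -ᶻ_; _^_ to _^ᶻ_; _≤_ to _≤ᶻ_)
open import Data.Integer.Divisibility.Signed using (_∣_; divides; ∣m∣n⇒∣m+n; ∣m⇒∣-m)
import Data.Integer.Properties as ℤ
open import Data.Integer.Tactic.RingSolver using (solve-∀)
open import Data.List using ([]; _∷_; map; foldr; upTo; applyUpTo)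
open import Data.List.Relation.Unary.All as All using ([]; _∷_)
open import Data.List.Relation.Unary.AllPairs using ([]; _∷_)
open import Data.Nat using (zero; suc; _<_; z≤n; s≤s; s≤s⁻¹; _∸_; _≡ᵇ_)
open import Data.Nat.DivMod using (_/_; _%_; m<n⇒m/n≡0; m<n⇒m%n≡m; [m+n]%n≡m%n; m/n≡1+[m∸n]/n)
import Data.Nat.Properties as ℕ
open import Data.Product using (_,_)
open import Data.Sum using (_⊎_; inj₁; inj₂)
open import Data.Unit using (tt)
open import Function using (_∘_)
open import Level using (0ℓ)
open import Relation.Binary.Bundles using (Setoid)
open import Relation.Binary.PropositionalEquality
open import Relation.Nullary.Decidable using (toWitness)

-- Finite sums

∑ : ℕ → (ℕ → ℤ) → ℤ
∑ zero    f = + 0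
∑ (suc n) f = f 0 +ᶻ ∑ n (f ∘ suc)

syntax ∑ n (λ h → e) = ∑[ h < n ] e

sumℤ-applyUpTo : ∀ (f : ℕ → ℤ) g n → sumℤ (map f (applyUpTo g n)) ≡ ∑ n (f ∘ g)
sumℤ-applyUpTo f g zero    = refl
sumℤ-applyUpTo f g (suc n) = cong (f (g 0) +ᶻ_) (sumℤ-applyUpTo f (g ∘ suc) n)

∑-cong : ∀ n {f g : ℕ → ℤ} → (∀ h → h < n → f h ≡ g h) → ∑ n f ≡ ∑ n g
∑-cong zero    f≡g = refl
∑-cong (suc n) f≡g = cong₂ _+ᶻ_ (f≡g 0 (s≤s z≤n)) (∑-cong n (λ h h<n → f≡g (suc h) (s≤s h<n)))

∑-+ : ∀ n (f g : ℕ → ℤ) → ∑[ h < n ] (f h +ᶻ g h) ≡ ∑ n f +ᶻ ∑ n g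
∑-+ zero    f g = refl
∑-+ (suc n) f g = trans (cong (f 0 +ᶻ g 0 +ᶻ_) (∑-+ n (f ∘ suc) (g ∘ suc))) (interchange (f 0) (g 0) _ _)
  where
  interchange : ∀ a b c d → a +ᶻ b +ᶻ (c +ᶻ d) ≡ a +ᶻ c +ᶻ (b +ᶻ d)
  interchange = solve-∀

∑-*ˡ : ∀ n c (f : ℕ → ℤ) → ∑[ h < n ] (c *ᶻ f h) ≡ c *ᶻ ∑ n f
∑-*ˡ zero    c f = sym (ℤ.*-zeroʳ c)
∑-*ˡ (suc n) c f = trans (cong (c *ᶻ f 0 +ᶻ_) (∑-*ˡ n c (f ∘ suc))) (sym (ℤ.*-distribˡ-+ c (f 0) _))

∑-const : ∀ n c → ∑[ h < n ] c ≡ + n *ᶻ c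
∑-const zero    c = refl
∑-const (suc n) c = trans (cong (c +ᶻ_) (∑-const n c)) (sym (ℤ.suc-* (+ n) c))

∑-neg : ∀ n (f : ℕ → ℤ) → ∑[ h < n ] (-ᶻ f h) ≡ -ᶻ ∑ n f
∑-neg n f = begin
  ∑[ h < n ] (-ᶻ f h)      ≡⟨ ∑-cong n (λ h _ → ℤ.-1*i≡-i (f h)) ⟨
  ∑[ h < n ] (-1ℤ *ᶻ f h)  ≡⟨ ∑-*ˡ n -1ℤ f ⟩
  -1ℤ *ᶻ ∑ n f             ≡⟨ ℤ.-1*i≡-i (∑ n f) ⟩
  -ᶻ ∑ n f                 ∎
  where open ≡-Reasoning

∑-- : ∀ n (f g : ℕ → ℤ) → ∑[ h < n ] (f h -ᶻ g h) ≡ ∑ n f -ᶻ ∑ n g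
∑-- n f g = trans (∑-+ n f (-ᶻ_ ∘ g)) (cong (∑ n f +ᶻ_) (∑-neg n g))

∑[1-f] : ∀ n (f : ℕ → ℤ) → ∑[ h < n ] (+ 1 -ᶻ f h) ≡ + n -ᶻ ∑ n f
∑[1-f] n f = trans (∑-- n (λ _ → + 1) f) (cong (_-ᶻ ∑ n f) (trans (∑-const n (+ 1)) (ℤ.*-identityʳ (+ n))))

∑[1+f]+∑[1-f] : ∀ n (f : ℕ → ℤ) → ∑[ h < n ] (+ 1 +ᶻ f h) +ᶻ ∑[ h < n ] (+ 1 -ᶻ f h) ≡ + n *ᶻ + 2
∑[1+f]+∑[1-f] n f = begin
  ∑[ h < n ] (+ 1 +ᶻ f h) +ᶻ ∑[ h < n ] (+ 1 -ᶻ f h)  ≡⟨ ∑-+ n _ _ ⟨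
  ∑[ h < n ] ((+ 1 +ᶻ f h) +ᶻ (+ 1 -ᶻ f h))          ≡⟨ ∑-cong n (λ h _ → [1+x]+[1-x]≡2 (f h)) ⟩
  ∑[ h < n ] (+ 2)                                   ≡⟨ ∑-const n (+ 2) ⟩
  + n *ᶻ + 2                                         ∎
  where
  open ≡-Reasoning
  [1+x]+[1-x]≡2 : ∀ x → (+ 1 +ᶻ x) +ᶻ (+ 1 -ᶻ x) ≡ + 2
  [1+x]+[1-x]≡2 = solve-∀

∑-affine : ∀ n c (f k : ℕ → ℤ) → ∑[ h < n ] (c +ᶻ f h +ᶻ k h) ≡ + n *ᶻ c +ᶻ ∑ n f +ᶻ ∑ n k
∑-affine n c f k = begin
  ∑[ h < n ] (c +ᶻ f h +ᶻ k h)                ≡⟨ ∑-+ n (λ h → c +ᶻ f h) k ⟩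
  ∑[ h < n ] (c +ᶻ f h) +ᶻ ∑ n k              ≡⟨ cong (_+ᶻ ∑ n k) (∑-+ n (λ _ → c) f) ⟩
  ∑[ h < n ] c +ᶻ ∑ n f +ᶻ ∑ n k              ≡⟨ cong (λ x → x +ᶻ ∑ n f +ᶻ ∑ n k) (∑-const n c) ⟩
  + n *ᶻ c +ᶻ ∑ n f +ᶻ ∑ n k                  ∎
  where open ≡-Reasoning

∑-++ : ∀ m n (f : ℕ → ℤ) → ∑ (m + n) f ≡ ∑ m f +ᶻ ∑[ h < n ] f (m + h)
∑-++ zero    n f = sym (ℤ.+-identityˡ _)
∑-++ (suc m) n f = trans (cong (f 0 +ᶻ_) (∑-++ m n (f ∘ suc))) (sym (ℤ.+-assoc (f 0) _ _))

∑-last : ∀ n (f : ℕ → ℤ) → ∑ (suc n) f ≡ ∑ n f +ᶻ f n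
∑-last n f = begin
  ∑ (suc n) f                  ≡⟨ cong (λ k → ∑ k f) (ℕ.+-comm 1 n) ⟩
  ∑ (n + 1) f                  ≡⟨ ∑-++ n 1 f ⟩
  ∑ n f +ᶻ (f (n + 0) +ᶻ + 0)  ≡⟨ cong (λ x → ∑ n f +ᶻ (f x +ᶻ + 0)) (ℕ.+-identityʳ n) ⟩
  ∑ n f +ᶻ (f n +ᶻ + 0)        ≡⟨ cong (∑ n f +ᶻ_) (ℤ.+-identityʳ (f n)) ⟩
  ∑ n f +ᶻ f n                 ∎
  where open ≡-Reasoning

∑-rotated-affine : ∀ {n} m g c (a : ℕ → ℤ) → g + m ≡ n →
  ∑[ h < m ] (c +ᶻ a h +ᶻ a (g + h) -ᶻ + 2) +ᶻ ∑[ h < g ] (c +ᶻ a (m + h) +ᶻ a h)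
    ≡ + n *ᶻ c +ᶻ (∑ n a +ᶻ ∑ n a) -ᶻ + 2 *ᶻ + m
∑-rotated-affine {n} m g c a g+m≡n = begin
  ∑[ h < m ] (c +ᶻ a h +ᶻ a (g + h) -ᶻ + 2) +ᶻ ∑[ h < g ] (c +ᶻ a (m + h) +ᶻ a h)
    ≡⟨ cong₂ _+ᶻ_ (∑-+ m (λ h → c +ᶻ a h +ᶻ a (g + h)) (λ _ → -ᶻ + 2)) (∑-affine g c (λ h → a (m + h)) a) ⟩
  ∑[ h < m ] (c +ᶻ a h +ᶻ a (g + h)) +ᶻ ∑[ h < m ] (-ᶻ + 2) +ᶻ (+ g *ᶻ c +ᶻ B₁ +ᶻ B₂)
    ≡⟨ cong₂ (λ x y → x +ᶻ y +ᶻ (+ g *ᶻ c +ᶻ B₁ +ᶻ B₂)) (∑-affine m c a (λ h → a (g + h))) (∑-const m (-ᶻ + 2)) ⟩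
  + m *ᶻ c +ᶻ A₁ +ᶻ A₂ +ᶻ + m *ᶻ (-ᶻ + 2) +ᶻ (+ g *ᶻ c +ᶻ B₁ +ᶻ B₂)
    ≡⟨ regroup (+ m) (+ g) c A₁ A₂ B₁ B₂ ⟩
  (+ m +ᶻ + g) *ᶻ c +ᶻ ((A₁ +ᶻ B₁) +ᶻ (B₂ +ᶻ A₂)) -ᶻ + 2 *ᶻ + m
    ≡⟨ cong₂ (λ x y → x *ᶻ c +ᶻ y -ᶻ + 2 *ᶻ + m) +m+g≡+n (cong₂ _+ᶻ_ A₁+B₁≡A B₂+A₂≡A) ⟩
  + n *ᶻ c +ᶻ (∑ n a +ᶻ ∑ n a) -ᶻ + 2 *ᶻ + m ∎
  where
  open ≡-Reasoning
  A₁ = ∑ m a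
  A₂ = ∑[ h < m ] a (g + h)
  B₁ = ∑[ h < g ] a (m + h)
  B₂ = ∑ g a
  m+g≡n : m + g ≡ n
  m+g≡n = trans (ℕ.+-comm m g) g+m≡n
  +m+g≡+n : + m +ᶻ + g ≡ + n
  +m+g≡+n = trans (sym (ℤ.pos-+ m g)) (cong +_ m+g≡n)
  A₁+B₁≡A : A₁ +ᶻ B₁ ≡ ∑ n a
  A₁+B₁≡A = trans (sym (∑-++ m g a)) (cong (λ k → ∑ k a) m+g≡n)
  B₂+A₂≡A : B₂ +ᶻ A₂ ≡ ∑ n a
  B₂+A₂≡A = trans (sym (∑-++ g m a)) (cong (λ k → ∑ k a) g+m≡n)
  regroup : ∀ m g c A₁ A₂ B₁ B₂ →
    m *ᶻ c +ᶻ A₁ +ᶻ A₂ +ᶻ m *ᶻ (-ᶻ + 2) +ᶻ (g *ᶻ c +ᶻ B₁ +ᶻ B₂)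
      ≡ (m +ᶻ g) *ᶻ c +ᶻ ((A₁ +ᶻ B₁) +ᶻ (B₂ +ᶻ A₂)) -ᶻ + 2 *ᶻ m
  regroup = solve-∀

∑-mono-≤ : ∀ n {f g : ℕ → ℤ} → (∀ h → f h ≤ᶻ g h) → ∑ n f ≤ᶻ ∑ n g
∑-mono-≤ zero    f≤g = ℤ.≤-refl
∑-mono-≤ (suc n) f≤g = ℤ.+-mono-≤ (f≤g 0) (∑-mono-≤ n (f≤g ∘ suc))

∑-adjacent-≤ : ∀ n {d f : ℕ → ℤ} → (∀ h → d h ≤ᶻ f h +ᶻ f (suc h)) →
  ∑ n d +ᶻ (f 0 +ᶻ f n) ≤ᶻ + 2 *ᶻ ∑ (suc n) f
∑-adjacent-≤ n {d} {f} d≤f+f′ = begin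
  ∑ n d +ᶻ (f 0 +ᶻ f n)                              ≤⟨ ℤ.+-monoˡ-≤ (f 0 +ᶻ f n) (∑-mono-≤ n d≤f+f′) ⟩
  ∑[ h < n ] (f h +ᶻ f (suc h)) +ᶻ (f 0 +ᶻ f n)      ≡⟨ cong (_+ᶻ (f 0 +ᶻ f n)) (∑-+ n f (f ∘ suc)) ⟩
  ∑ n f +ᶻ ∑ n (f ∘ suc) +ᶻ (f 0 +ᶻ f n)             ≡⟨ regroup (∑ n f) (∑ n (f ∘ suc)) (f 0) (f n) ⟩
  (∑ n f +ᶻ f n) +ᶻ (f 0 +ᶻ ∑ n (f ∘ suc))           ≡⟨ cong (_+ᶻ ∑ (suc n) f) (∑-last n f) ⟨
  ∑ (suc n) f +ᶻ ∑ (suc n) f                         ≡⟨ x+x≡2x (∑ (suc n) f) ⟩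
  + 2 *ᶻ ∑ (suc n) f                                 ∎
  where
  open ℤ.≤-Reasoning
  regroup : ∀ A B x y → A +ᶻ B +ᶻ (x +ᶻ y) ≡ (A +ᶻ y) +ᶻ (x +ᶻ B)
  regroup = solve-∀
  x+x≡2x : ∀ x → x +ᶻ x ≡ + 2 *ᶻ x
  x+x≡2x = solve-∀

∑ℕ : ℕ → (ℕ → ℕ) → ℕ
∑ℕ zero    f = 0
∑ℕ (suc n) f = f 0 + ∑ℕ n (f ∘ suc)

∑ℕ-cong : ∀ n {f g : ℕ → ℕ} → (∀ j → f j ≡ g j) → ∑ℕ n f ≡ ∑ℕ n g
∑ℕ-cong zero    f≡g = refl
∑ℕ-cong (suc n) f≡g = cong₂ _+_ (f≡g 0) (∑ℕ-cong n (f≡g ∘ suc))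

sum-map-suc-applyUpTo : ∀ (f : ℕ → ℕ) k n → foldr _+_ 0 (map f (map suc (applyUpTo k n))) ≡ ∑ℕ n (f ∘ suc ∘ k)
sum-map-suc-applyUpTo f k zero    = refl
sum-map-suc-applyUpTo f k (suc n) = cong (_+_ (f (suc (k 0)))) (sum-map-suc-applyUpTo f (k ∘ suc) n)

2*k≤∑ℕ-evens : ∀ k (f : ℕ → ℕ) → (∀ j → j < k → 2 ≤ f (j * 2)) → k * 2 ≤ ∑ℕ (k * 2) f
2*k≤∑ℕ-evens zero    f 2≤f[2j] = z≤n
2*k≤∑ℕ-evens (suc k) f 2≤f[2j] = ℕ.+-mono-≤ (2≤f[2j] 0 (s≤s z≤n))
  (ℕ.≤-trans (2*k≤∑ℕ-evens k (f ∘ suc ∘ suc) (λ j j<k → 2≤f[2j] (suc j) (s≤s j<k))) (ℕ.m≤n+m _ (f 1)))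

-- Congruence modulo 4

infix 4 _≡₄_

record _≡₄_ (x y : ℤ) : Set where
  constructor 4∣-
  field 4∣difference : + 4 ∣ x -ᶻ y

≡₄-reflexive : ∀ {x y} → x ≡ y → x ≡₄ y
≡₄-reflexive {x} refl = 4∣- (divides (+ 0) (ℤ.+-inverseʳ x))

≡₄-sym : ∀ {x y} → x ≡₄ y → y ≡₄ x
≡₄-sym {x} {y} (4∣- 4∣x-y) = 4∣- (subst (+ 4 ∣_) (neg-difference x y) (∣m⇒∣-m 4∣x-y))
  where
  neg-difference : ∀ x y → -ᶻ (x -ᶻ y) ≡ y -ᶻ x
  neg-difference = solve-∀

≡₄-trans : ∀ {x y z} → x ≡₄ y → y ≡₄ z → x ≡₄ z
≡₄-trans {x} {y} {z} (4∣- 4∣x-y) (4∣- 4∣y-z) =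
  4∣- (subst (+ 4 ∣_) (telescope x y z) (∣m∣n⇒∣m+n 4∣x-y 4∣y-z))
  where
  telescope : ∀ x y z → x -ᶻ y +ᶻ (y -ᶻ z) ≡ x -ᶻ z
  telescope = solve-∀

≡₄-+ : ∀ {x y x′ y′} → x ≡₄ y → x′ ≡₄ y′ → x +ᶻ x′ ≡₄ y +ᶻ y′
≡₄-+ {x} {y} {x′} {y′} (4∣- 4∣x-y) (4∣- 4∣x′-y′) =
  4∣- (subst (+ 4 ∣_) (regroup x y x′ y′) (∣m∣n⇒∣m+n 4∣x-y 4∣x′-y′))
  where
  regroup : ∀ x y x′ y′ → x -ᶻ y +ᶻ (x′ -ᶻ y′) ≡ x +ᶻ x′ -ᶻ (y +ᶻ y′)
  regroup = solve-∀

≡₄-+4* : ∀ x k → x +ᶻ + 4 *ᶻ k ≡₄ x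
≡₄-+4* x k = 4∣- (divides k (difference x k))
  where
  difference : ∀ x k → x +ᶻ + 4 *ᶻ k -ᶻ x ≡ k *ᶻ + 4
  difference = solve-∀

∑-≡₄ : ∀ n {f g : ℕ → ℤ} → (∀ h → f h ≡₄ g h) → ∑ n f ≡₄ ∑ n g
∑-≡₄ zero    f≡₄g = ≡₄-reflexive refl
∑-≡₄ (suc n) f≡₄g = ≡₄-+ (f≡₄g 0) (∑-≡₄ n (f≡₄g ∘ suc))

≡₄-setoid : Setoid 0ℓ 0ℓ
≡₄-setoid = record
  { Carrier       = ℤ
  ; _≈_           = _≡₄_
  ; isEquivalence = record { refl = ≡₄-reflexive refl ; sym = ≡₄-sym ; trans = ≡₄-trans }
  }

≡₄2⇒2≤∣∣ : ∀ {x} → x ≡₄ + 2 → 2 ≤ ∣ x ∣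
≡₄2⇒2≤∣∣ {x} (4∣- (divides k x-2≡4k)) = subst (λ y → 2 ≤ ∣ y ∣) (sym x≡2+4k) (2≤∣2+4k∣ k)
  where
  x≡2+4k : x ≡ + 2 +ᶻ k *ᶻ + 4
  x≡2+4k = trans (x≡2+[x-2] x) (cong (+ 2 +ᶻ_) x-2≡4k)
    where
    x≡2+[x-2] : ∀ x → x ≡ + 2 +ᶻ (x -ᶻ + 2)
    x≡2+[x-2] = solve-∀
  2≤∣2+4k∣ : ∀ k → 2 ≤ ∣ + 2 +ᶻ k *ᶻ + 4 ∣
  2≤∣2+4k∣ (+ n)    rewrite sym (ℤ.pos-* n 4) = s≤s (s≤s z≤n)
  2≤∣2+4k∣ -[1+ n ] = s≤s (s≤s z≤n)

-- Signs

IsSign : ℤ → Set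
IsSign x = x ≡ + 1 ⊎ x ≡ -1ℤ

IsSign-* : ∀ {u v} → IsSign u → IsSign v → IsSign (u *ᶻ v)
IsSign-* (inj₁ refl) (inj₁ refl) = inj₁ refl
IsSign-* (inj₁ refl) (inj₂ refl) = inj₂ refl
IsSign-* (inj₂ refl) (inj₁ refl) = inj₂ refl
IsSign-* (inj₂ refl) (inj₂ refl) = inj₁ refl

sign*x≡0⇒x≡0 : ∀ {u} x → IsSign u → u *ᶻ x ≡ + 0 → x ≡ + 0
sign*x≡0⇒x≡0 x (inj₁ refl) x≡0   = trans (sym (ℤ.*-identityˡ x)) x≡0
sign*x≡0⇒x≡0 x (inj₂ refl) -x≡0 = trans (sym (ℤ.neg-involutive x)) (cong -ᶻ_ (trans (sym (ℤ.-1*i≡-i x)) -x≡0))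

sign+sign≡₄2 : ∀ {u} → IsSign u → u +ᶻ u ≡₄ + 2
sign+sign≡₄2 (inj₁ refl) = 4∣- (divides (+ 0) refl)
sign+sign≡₄2 (inj₂ refl) = 4∣- (divides -1ℤ refl)

sign³≡₄ : ∀ {u v w} → IsSign u → IsSign v → IsSign w → u *ᶻ v *ᶻ w ≡₄ u +ᶻ v +ᶻ w -ᶻ + 2
sign³≡₄ (inj₁ refl) (inj₁ refl) (inj₁ refl) = 4∣- (divides (+ 0) refl)
sign³≡₄ (inj₁ refl) (inj₁ refl) (inj₂ refl) = 4∣- (divides (+ 0) refl)
sign³≡₄ (inj₁ refl) (inj₂ refl) (inj₁ refl) = 4∣- (divides (+ 0) refl)
sign³≡₄ (inj₂ refl) (inj₁ refl) (inj₁ refl) = 4∣- (divides (+ 0) refl)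
sign³≡₄ (inj₁ refl) (inj₂ refl) (inj₂ refl) = 4∣- (divides (+ 1) refl)
sign³≡₄ (inj₂ refl) (inj₁ refl) (inj₂ refl) = 4∣- (divides (+ 1) refl)
sign³≡₄ (inj₂ refl) (inj₂ refl) (inj₁ refl) = 4∣- (divides (+ 1) refl)
sign³≡₄ (inj₂ refl) (inj₂ refl) (inj₂ refl) = 4∣- (divides (+ 1) refl)

-sign³≡₄ : ∀ {u v w} → IsSign u → IsSign v → IsSign w → -ᶻ (u *ᶻ v *ᶻ w) ≡₄ u +ᶻ v +ᶻ w
-sign³≡₄ (inj₁ refl) (inj₁ refl) (inj₁ refl) = 4∣- (divides -1ℤ refl)
-sign³≡₄ (inj₁ refl) (inj₁ refl) (inj₂ refl) = 4∣- (divides (+ 0) refl)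
-sign³≡₄ (inj₁ refl) (inj₂ refl) (inj₁ refl) = 4∣- (divides (+ 0) refl)
-sign³≡₄ (inj₂ refl) (inj₁ refl) (inj₁ refl) = 4∣- (divides (+ 0) refl)
-sign³≡₄ (inj₁ refl) (inj₂ refl) (inj₂ refl) = 4∣- (divides (+ 0) refl)
-sign³≡₄ (inj₂ refl) (inj₁ refl) (inj₂ refl) = 4∣- (divides (+ 0) refl)
-sign³≡₄ (inj₂ refl) (inj₂ refl) (inj₁ refl) = 4∣- (divides (+ 0) refl)
-sign³≡₄ (inj₂ refl) (inj₂ refl) (inj₂ refl) = 4∣- (divides (+ 1) refl)

∑sign+∑sign≡₄2n : ∀ n {a : ℕ → ℤ} → (∀ h → IsSign (a h)) → ∑ n a +ᶻ ∑ n a ≡₄ + n *ᶻ + 2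
∑sign+∑sign≡₄2n n {a} a-sign = begin
  ∑ n a +ᶻ ∑ n a          ≡⟨ ∑-+ n a a ⟨
  ∑[ h < n ] (a h +ᶻ a h) ≈⟨ ∑-≡₄ n (λ h → sign+sign≡₄2 (a-sign h)) ⟩
  ∑[ h < n ] (+ 2)        ≡⟨ ∑-const n (+ 2) ⟩
  + n *ᶻ + 2              ∎
  where open import Relation.Binary.Reasoning.Setoid ≡₄-setoid

1-sign²≤[1-sign]+[1-sign] : ∀ {u v} → IsSign u → IsSign v → + 1 -ᶻ u *ᶻ v ≤ᶻ (+ 1 -ᶻ u) +ᶻ (+ 1 -ᶻ v)
1-sign²≤[1-sign]+[1-sign] (inj₁ refl) (inj₁ refl) = toWitness {a? = _ ℤ.≤? _} tt
1-sign²≤[1-sign]+[1-sign] (inj₁ refl) (inj₂ refl) = toWitness {a? = _ ℤ.≤? _} tt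
1-sign²≤[1-sign]+[1-sign] (inj₂ refl) (inj₁ refl) = toWitness {a? = _ ℤ.≤? _} tt
1-sign²≤[1-sign]+[1-sign] (inj₂ refl) (inj₂ refl) = toWitness {a? = _ ℤ.≤? _} tt

1-sign²≤[1+sign]+[1+sign] : ∀ {u v} → IsSign u → IsSign v → + 1 -ᶻ u *ᶻ v ≤ᶻ (+ 1 +ᶻ u) +ᶻ (+ 1 +ᶻ v)
1-sign²≤[1+sign]+[1+sign] (inj₁ refl) (inj₁ refl) = toWitness {a? = _ ℤ.≤? _} tt
1-sign²≤[1+sign]+[1+sign] (inj₁ refl) (inj₂ refl) = toWitness {a? = _ ℤ.≤? _} tt
1-sign²≤[1+sign]+[1+sign] (inj₂ refl) (inj₁ refl) = toWitness {a? = _ ℤ.≤? _} tt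
1-sign²≤[1+sign]+[1+sign] (inj₂ refl) (inj₂ refl) = toWitness {a? = _ ℤ.≤? _} tt

sign-changes≤2*negatives : ∀ n {a : ℕ → ℤ} → (∀ h → IsSign (a h)) → a 0 ≡ + 1 → a n ≡ + 1 →
  ∑[ h < n ] (+ 1 -ᶻ a h *ᶻ a (suc h)) ≤ᶻ + 2 *ᶻ ∑[ h < suc n ] (+ 1 -ᶻ a h)
sign-changes≤2*negatives n {a} a-sign a₀≡1 aₙ≡1 = subst (λ x → x ≤ᶻ + 2 *ᶻ ∑[ h < suc n ] (+ 1 -ᶻ a h)) ends≡0
  (∑-adjacent-≤ n {f = λ h → + 1 -ᶻ a h} (λ h → 1-sign²≤[1-sign]+[1-sign] (a-sign h) (a-sign (suc h))))
  where
  ends≡0 : ∑[ h < n ] (+ 1 -ᶻ a h *ᶻ a (suc h)) +ᶻ ((+ 1 -ᶻ a 0) +ᶻ (+ 1 -ᶻ a n))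
         ≡ ∑[ h < n ] (+ 1 -ᶻ a h *ᶻ a (suc h))
  ends≡0 rewrite a₀≡1 | aₙ≡1 = ℤ.+-identityʳ _

sign-changes+4≤2*positives : ∀ n {a : ℕ → ℤ} → (∀ h → IsSign (a h)) → a 0 ≡ + 1 → a n ≡ + 1 →
  ∑[ h < n ] (+ 1 -ᶻ a h *ᶻ a (suc h)) +ᶻ + 4 ≤ᶻ + 2 *ᶻ ∑[ h < suc n ] (+ 1 +ᶻ a h)
sign-changes+4≤2*positives n {a} a-sign a₀≡1 aₙ≡1 = subst (λ x → x ≤ᶻ + 2 *ᶻ ∑[ h < suc n ] (+ 1 +ᶻ a h)) ends≡4
  (∑-adjacent-≤ n {f = λ h → + 1 +ᶻ a h} (λ h → 1-sign²≤[1+sign]+[1+sign] (a-sign h) (a-sign (suc h))))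
  where
  ends≡4 : ∑[ h < n ] (+ 1 -ᶻ a h *ᶻ a (suc h)) +ᶻ ((+ 1 +ᶻ a 0) +ᶻ (+ 1 +ᶻ a n))
         ≡ ∑[ h < n ] (+ 1 -ᶻ a h *ᶻ a (suc h)) +ᶻ + 4
  ends≡4 rewrite a₀≡1 | aₙ≡1 = refl

-- Row sums of γ twisted by a coboundary

+N≡2+4t : ∀ t → + N t ≡ + 2 +ᶻ + 4 *ᶻ + t
+N≡2+4t t = trans (ℤ.pos-+ 2 (4 * t)) (cong (+ 2 +ᶻ_) (ℤ.pos-* 4 t))

N*sign≡₄2 : ∀ t {u} → IsSign u → + N t *ᶻ u ≡₄ + 2
N*sign≡₄2 t (inj₁ refl) =
  ≡₄-trans (≡₄-reflexive (trans (ℤ.*-identityʳ (+ N t)) (+N≡2+4t t))) (≡₄-+4* (+ 2) (+ t))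
N*sign≡₄2 t (inj₂ refl) = 4∣- (divides (-1ℤ -ᶻ + t) (begin
  + N t *ᶻ -1ℤ -ᶻ + 2                 ≡⟨ cong (λ x → x *ᶻ -1ℤ -ᶻ + 2) (+N≡2+4t t) ⟩
  (+ 2 +ᶻ + 4 *ᶻ + t) *ᶻ -1ℤ -ᶻ + 2   ≡⟨ -[2+4t]-2≡[-1-t]*4 (+ t) ⟩
  (-1ℤ -ᶻ + t) *ᶻ + 4                 ∎))
  where
  open ≡-Reasoning
  -[2+4t]-2≡[-1-t]*4 : ∀ t → (+ 2 +ᶻ + 4 *ᶻ t) *ᶻ -1ℤ -ᶻ + 2 ≡ (-1ℤ -ᶻ t) *ᶻ + 4
  -[2+4t]-2≡[-1-t]*4 = solve-∀

γ-< : ∀ t g h → g + h < N t → γ t g h ≡ + 1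
γ-< t g h g+h<N = cong (-1ℤ ^ᶻ_) (m<n⇒m/n≡0 g+h<N)

γ-wrap : ∀ t g h k → g + h ≡ N t + k → k < N t → γ t g h ≡ -1ℤ
γ-wrap t g h k g+h≡N+k k<N = cong (-1ℤ ^ᶻ_) (begin
  (g + h) / N t          ≡⟨ cong (_/ N t) g+h≡N+k ⟩
  (N t + k) / N t        ≡⟨ m/n≡1+[m∸n]/n (ℕ.m≤m+n (N t) k) ⟩
  1 + (N t + k ∸ N t) / N t ≡⟨ cong (λ x → 1 + x / N t) (ℕ.m+n∸m≡n (N t) k) ⟩
  1 + k / N t            ≡⟨ cong suc (m<n⇒m/n≡0 k<N) ⟩
  1                      ∎)
  where open ≡-Reasoning

%-wrap : ∀ t g h k → g + h ≡ N t + k → k < N t → (g + h) % N t ≡ k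
%-wrap t g h k g+h≡N+k k<N = begin
  (g + h) % N t   ≡⟨ cong (_% N t) (trans g+h≡N+k (ℕ.+-comm (N t) k)) ⟩
  (k + N t) % N t ≡⟨ [m+n]%n≡m%n k (N t) ⟩
  k % N t         ≡⟨ m<n⇒m%n≡m k<N ⟩
  k               ∎
  where open ≡-Reasoning

coboundary : ℕ → (ℕ → ℤ) → ℕ → ℕ → ℤ
coboundary t a g h = a g *ᶻ a h *ᶻ a ((g + h) % N t)

γ∂ : ℕ → (ℕ → ℤ) → ℕ → ℕ → ℤ
γ∂ t a g h = γ t g h *ᶻ coboundary t a g h

rowSum : ℕ → (ℕ → ℕ → ℤ) → ℕ → ℤ
rowSum t f g = ∑[ h < N t ] f g h

rowSum-γ∂-split : ∀ t a g m → g + m ≡ N t →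
  rowSum t (γ∂ t a) g ≡ ∑[ h < m ] (a g *ᶻ a h *ᶻ a (g + h)) +ᶻ ∑[ h < g ] (-ᶻ (a g *ᶻ a (m + h) *ᶻ a h))
rowSum-γ∂-split t a g m g+m≡N = begin
  ∑ (N t) (γ∂ t a g)                                       ≡⟨ cong (λ n → ∑ n (γ∂ t a g)) (sym m+g≡N) ⟩
  ∑ (m + g) (γ∂ t a g)                                     ≡⟨ ∑-++ m g (γ∂ t a g) ⟩
  ∑ m (γ∂ t a g) +ᶻ ∑[ h < g ] γ∂ t a g (m + h)            ≡⟨ cong₂ _+ᶻ_ (∑-cong m unwrapped) (∑-cong g wrapped) ⟩
  ∑[ h < m ] (a g *ᶻ a h *ᶻ a (g + h)) +ᶻ ∑[ h < g ] (-ᶻ (a g *ᶻ a (m + h) *ᶻ a h)) ∎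
  where
  open ≡-Reasoning
  m+g≡N : m + g ≡ N t
  m+g≡N = trans (ℕ.+-comm m g) g+m≡N
  unwrapped : ∀ h → h < m → γ∂ t a g h ≡ a g *ᶻ a h *ᶻ a (g + h)
  unwrapped h h<m = trans (cong₂ (λ x y → x *ᶻ (a g *ᶻ a h *ᶻ a y)) (γ-< t g h g+h<N) (m<n⇒m%n≡m g+h<N))
                          (ℤ.*-identityˡ _)
    where
    g+h<N : g + h < N t
    g+h<N = subst (g + h <_) g+m≡N (ℕ.+-monoʳ-< g h<m)
  wrapped : ∀ h → h < g → γ∂ t a g (m + h) ≡ -ᶻ (a g *ᶻ a (m + h) *ᶻ a h)
  wrapped h h<g = trans (cong₂ (λ x y → x *ᶻ (a g *ᶻ a (m + h) *ᶻ a y))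
                               (γ-wrap t g (m + h) h g+m+h≡N+h h<N) (%-wrap t g (m + h) h g+m+h≡N+h h<N))
                        (ℤ.-1*i≡-i _)
    where
    g+m+h≡N+h : g + (m + h) ≡ N t + h
    g+m+h≡N+h = trans (sym (ℕ.+-assoc g m h)) (cong (_+ h) g+m≡N)
    h<N : h < N t
    h<N = ℕ.<-≤-trans h<g (subst (g ≤_) g+m≡N (ℕ.m≤m+n g m))

rowSum-γ∂-≡₄ : ∀ t a g → (∀ h → IsSign (a h)) → g ≤ N t → rowSum t (γ∂ t a) g ≡₄ + 2 +ᶻ + 2 *ᶻ + g
rowSum-γ∂-≡₄ t a g a-sign g≤N with ℕ.m≤n⇒∃[o]m+o≡n g≤N
... | m , g+m≡N = begin
  rowSum t (γ∂ t a) g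
    ≡⟨ rowSum-γ∂-split t a g m g+m≡N ⟩
  ∑[ h < m ] (a g *ᶻ a h *ᶻ a (g + h)) +ᶻ ∑[ h < g ] (-ᶻ (a g *ᶻ a (m + h) *ᶻ a h))
    ≈⟨ ≡₄-+ (∑-≡₄ m (λ h → sign³≡₄ (a-sign g) (a-sign h) (a-sign (g + h))))
             (∑-≡₄ g (λ h → -sign³≡₄ (a-sign g) (a-sign (m + h)) (a-sign h))) ⟩
  ∑[ h < m ] (a g +ᶻ a h +ᶻ a (g + h) -ᶻ + 2) +ᶻ ∑[ h < g ] (a g +ᶻ a (m + h) +ᶻ a h)
    ≡⟨ ∑-rotated-affine m g (a g) a g+m≡N ⟩
  + N t *ᶻ a g +ᶻ (∑ (N t) a +ᶻ ∑ (N t) a) -ᶻ + 2 *ᶻ + m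
    ≈⟨ ≡₄-+ (≡₄-+ (N*sign≡₄2 t (a-sign g)) (∑sign+∑sign≡₄2n (N t) a-sign)) (≡₄-reflexive refl) ⟩
  + 2 +ᶻ + N t *ᶻ + 2 -ᶻ + 2 *ᶻ + m
    ≡⟨ cong (λ n → + 2 +ᶻ n *ᶻ + 2 -ᶻ + 2 *ᶻ + m) (trans (sym (cong +_ g+m≡N)) (ℤ.pos-+ g m)) ⟩
  + 2 +ᶻ (+ g +ᶻ + m) *ᶻ + 2 -ᶻ + 2 *ᶻ + m
    ≡⟨ cancel-m (+ g) (+ m) ⟩
  + 2 +ᶻ + 2 *ᶻ + g ∎
  where
  open import Relation.Binary.Reasoning.Setoid ≡₄-setoid
  cancel-m : ∀ g m → + 2 +ᶻ (g +ᶻ m) *ᶻ + 2 -ᶻ + 2 *ᶻ m ≡ + 2 +ᶻ + 2 *ᶻ g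
  cancel-m = solve-∀

rowSum-γ∂-one : ∀ t a → a 0 ≡ + 1 → a (suc (4 * t)) ≡ + 1 →
  rowSum t (γ∂ t a) 1 ≡ a 1 *ᶻ (∑[ h < suc (4 * t) ] (a h *ᶻ a (suc h)) -ᶻ + 1)
rowSum-γ∂-one t a a₀≡1 aₙ≡1 = begin
  rowSum t (γ∂ t a) 1
    ≡⟨ rowSum-γ∂-split t a 1 n refl ⟩
  ∑[ h < n ] (a 1 *ᶻ a h *ᶻ a (suc h)) +ᶻ (-ᶻ (a 1 *ᶻ a (n + 0) *ᶻ a 0) +ᶻ + 0)
    ≡⟨ cong₂ (λ x y → x +ᶻ (-ᶻ (a 1 *ᶻ y *ᶻ a 0) +ᶻ + 0))
             (trans (∑-cong n (λ h _ → ℤ.*-assoc (a 1) (a h) (a (suc h)))) (∑-*ˡ n (a 1) (λ h → a h *ᶻ a (suc h))))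
             (trans (cong a (ℕ.+-identityʳ n)) aₙ≡1) ⟩
  a 1 *ᶻ P +ᶻ (-ᶻ (a 1 *ᶻ + 1 *ᶻ a 0) +ᶻ + 0)
    ≡⟨ cong (λ x → a 1 *ᶻ P +ᶻ (-ᶻ (a 1 *ᶻ + 1 *ᶻ x) +ᶻ + 0)) a₀≡1 ⟩
  a 1 *ᶻ P +ᶻ (-ᶻ (a 1 *ᶻ + 1 *ᶻ + 1) +ᶻ + 0)
    ≡⟨ factor (a 1) P ⟩
  a 1 *ᶻ (P -ᶻ + 1) ∎
  where
  open ≡-Reasoning
  n = suc (4 * t)
  P = ∑[ h < n ] (a h *ᶻ a (suc h))
  factor : ∀ x P → x *ᶻ P +ᶻ (-ᶻ (x *ᶻ + 1 *ᶻ + 1) +ᶻ + 0) ≡ x *ᶻ (P -ᶻ + 1)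
  factor = solve-∀

RE≡∑ℕ∣rowSum∣ : ∀ t f → RE t f ≡ ∑ℕ (suc (4 * t)) (λ j → ∣ rowSum t f (suc j) ∣)
RE≡∑ℕ∣rowSum∣ t f = trans (sum-map-suc-applyUpTo (λ g → ∣ sumℤ (map (f g) (upTo (N t))) ∣) (λ j → j) (suc (4 * t)))
  (∑ℕ-cong (suc (4 * t)) (λ j → cong ∣_∣ (sumℤ-applyUpTo (f (suc j)) (λ h → h) (N t))))

quasiOrthogonal⇒rowSum₁≡0 : ∀ t f → QuasiOrthogonal t f →
  (∀ j → j < 2 * t → 2 ≤ ∣ rowSum t f (2 + j * 2) ∣) → rowSum t f 1 ≡ + 0
quasiOrthogonal⇒rowSum₁≡0 t f RE≡4t 2≤∣even-rows∣ =
  ℤ.∣i∣≡0⇒i≡0 (ℕ.n≤0⇒n≡0 (ℕ.+-cancelʳ-≤ (4 * t) ∣R₁∣ 0 (begin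
    ∣R₁∣ + 4 * t                          ≡⟨ cong (_+_ ∣R₁∣) 4t≡2t*2 ⟩
    ∣R₁∣ + 2 * t * 2                      ≤⟨ ℕ.+-monoʳ-≤ ∣R₁∣ (2*k≤∑ℕ-evens (2 * t) ∣R₂₊∣ 2≤∣even-rows∣) ⟩
    ∣R₁∣ + ∑ℕ (2 * t * 2) ∣R₂₊∣           ≡⟨ cong (λ n → ∣R₁∣ + ∑ℕ n ∣R₂₊∣) 4t≡2t*2 ⟨
    ∑ℕ (suc (4 * t)) (∣R∣ ∘ suc)          ≡⟨ RE≡∑ℕ∣rowSum∣ t f ⟨
    RE t f                                ≡⟨ RE≡4t ⟩
    4 * t                                 ∎)))
  where
  open ℕ.≤-Reasoning
  ∣R∣ : ℕ → ℕ
  ∣R∣ g = ∣ rowSum t f g ∣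
  ∣R₁∣ = ∣R∣ 1
  ∣R₂₊∣ : ℕ → ℕ
  ∣R₂₊∣ j = ∣R∣ (2 + j)
  4t≡2t*2 : 4 * t ≡ 2 * t * 2
  4t≡2t*2 = trans (ℕ.*-assoc 2 2 t) (ℕ.*-comm 2 (2 * t))

-- The cocycle ψ

χ : List ℕ → ℕ → ℤ
χ is x = prodℤ (map (λ i → δ i x) is)

δ-isSign : ∀ i x → IsSign (δ i x)
δ-isSign i x with x ≡ᵇ (i ∸ 1)
... | true  = inj₂ refl
... | false = inj₁ refl

χ-isSign : ∀ is x → IsSign (χ is x)
χ-isSign []       x = inj₁ refl
χ-isSign (i ∷ is) x = IsSign-* (δ-isSign i x) (χ-isSign is x)

δ-≢ : ∀ i x → x ≢ i ∸ 1 → δ i x ≡ + 1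
δ-≢ i x x≢i-1 with x ≡ᵇ (i ∸ 1) in x≡ᵇi-1
... | true  = ⊥-elim (x≢i-1 (ℕ.≡ᵇ⇒≡ x (i ∸ 1) (subst T (sym x≡ᵇi-1) tt)))
... | false = refl

χ-≢ : ∀ is x → All (λ i → x ≢ i ∸ 1) is → χ is x ≡ + 1
χ-≢ []       x []                = refl
χ-≢ (i ∷ is) x (x≢i-1 ∷ x≢is-1) = cong₂ _*ᶻ_ (δ-≢ i x x≢i-1) (χ-≢ is x x≢is-1)

∑-*[1-δ] : ∀ n c (f : ℕ → ℤ) → c < n → ∑[ h < n ] (f h *ᶻ (+ 1 -ᶻ δ (suc c) h)) ≡ + 2 *ᶻ f c
∑-*[1-δ] (suc n) zero    f _ = begin
  f 0 *ᶻ + 2 +ᶻ ∑[ h < n ] (f (suc h) *ᶻ + 0)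
    ≡⟨ cong (f 0 *ᶻ + 2 +ᶻ_) (∑-cong n (λ h _ → ℤ.*-zeroʳ (f (suc h)))) ⟩
  f 0 *ᶻ + 2 +ᶻ ∑[ h < n ] (+ 0)
    ≡⟨ cong (f 0 *ᶻ + 2 +ᶻ_) (trans (∑-const n (+ 0)) (ℤ.*-zeroʳ (+ n))) ⟩
  f 0 *ᶻ + 2 +ᶻ + 0
    ≡⟨ x*2+0≡2*x (f 0) ⟩
  + 2 *ᶻ f 0 ∎
  where
  open ≡-Reasoning
  x*2+0≡2*x : ∀ x → x *ᶻ + 2 +ᶻ + 0 ≡ + 2 *ᶻ x
  x*2+0≡2*x = solve-∀
∑-*[1-δ] (suc n) (suc c) f (s≤s c<n) =
  trans (cong (f 0 *ᶻ + 0 +ᶻ_) (∑-*[1-δ] n c (f ∘ suc) c<n)) (x*0+y≡y (f 0) _)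
  where
  x*0+y≡y : ∀ x y → x *ᶻ + 0 +ᶻ y ≡ y
  x*0+y≡y = solve-∀

∑[1-χ]≡2*length : ∀ n is → Unique is → All (λ i → 1 ≤ i × i ≤ n) is →
  ∑[ h < n ] (+ 1 -ᶻ χ is h) ≡ + 2 *ᶻ + length is
∑[1-χ]≡2*length n [] [] [] = trans (∑-const n (+ 0)) (ℤ.*-zeroʳ (+ n))
∑[1-χ]≡2*length n (suc c ∷ is) (c∉is ∷ unique) ((s≤s z≤n , c<n) ∷ bounds) = begin
  ∑[ h < n ] (+ 1 -ᶻ δ (suc c) h *ᶻ χ is h)
    ≡⟨ ∑-cong n (λ h _ → split (δ (suc c) h) (χ is h)) ⟩
  ∑[ h < n ] ((+ 1 -ᶻ χ is h) +ᶻ χ is h *ᶻ (+ 1 -ᶻ δ (suc c) h))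
    ≡⟨ ∑-+ n _ _ ⟩
  ∑[ h < n ] (+ 1 -ᶻ χ is h) +ᶻ ∑[ h < n ] (χ is h *ᶻ (+ 1 -ᶻ δ (suc c) h))
    ≡⟨ cong₂ _+ᶻ_ (∑[1-χ]≡2*length n is unique bounds) (∑-*[1-δ] n c (χ is) c<n) ⟩
  + 2 *ᶻ + length is +ᶻ + 2 *ᶻ χ is c
    ≡⟨ cong (λ x → + 2 *ᶻ + length is +ᶻ + 2 *ᶻ x) (χ-≢ is c (c≢is-1 c∉is bounds)) ⟩
  + 2 *ᶻ + length is +ᶻ + 2 *ᶻ + 1
    ≡⟨ 2*w+2*1≡2*[1+w] (+ length is) ⟩
  + 2 *ᶻ + (1 + length is) ∎
  where
  open ≡-Reasoning
  split : ∀ d x → + 1 -ᶻ d *ᶻ x ≡ (+ 1 -ᶻ x) +ᶻ x *ᶻ (+ 1 -ᶻ d)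
  split = solve-∀
  2*w+2*1≡2*[1+w] : ∀ w → + 2 *ᶻ w +ᶻ + 2 *ᶻ + 1 ≡ + 2 *ᶻ (+ 1 +ᶻ w)
  2*w+2*1≡2*[1+w] = solve-∀
  c≢is-1 : ∀ {js} → All (suc c ≢_) js → All (λ j → 1 ≤ j × j ≤ n) js → All (λ j → c ≢ j ∸ 1) js
  c≢is-1 []             []                     = []
  c≢is-1 (c+1≢j ∷ c∉js) ((s≤s z≤n , _) ∷ bounds) = (λ c≡j-1 → c+1≢j (cong suc c≡j-1)) ∷ c≢is-1 c∉js bounds

χ₀≡1 : ∀ t is → All (λ i → 2 ≤ i × i ≤ 4 * t + 1) is → χ is 0 ≡ + 1
χ₀≡1 t is bounds = χ-≢ is 0 (All.map (λ { (s≤s (s≤s _) , _) () }) bounds)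

χ[4t+1]≡1 : ∀ t is → All (λ i → 2 ≤ i × i ≤ 4 * t + 1) is → χ is (suc (4 * t)) ≡ + 1
χ[4t+1]≡1 t is bounds = χ-≢ is (suc (4 * t)) (All.map 4t+1≢i-1 bounds)
  where
  4t+1≢i-1 : ∀ {i} → 2 ≤ i × i ≤ 4 * t + 1 → suc (4 * t) ≢ i ∸ 1
  4t+1≢i-1 {suc (suc k)} (_ , i≤4t+1) 4t+1≡k+1 =
    ℕ.1+n≰n (subst (_≤ 4 * t) (sym 4t+1≡k+1) (s≤s⁻¹ (subst (suc (suc k) ≤_) (ℕ.+-comm (4 * t) 1) i≤4t+1)))

prodℤ-map-* : ∀ (f g : ℕ → ℤ) is → prodℤ (map (λ i → f i *ᶻ g i) is) ≡ prodℤ (map f is) *ᶻ prodℤ (map g is)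
prodℤ-map-* f g []       = refl
prodℤ-map-* f g (i ∷ is) =
  trans (cong (f i *ᶻ g i *ᶻ_) (prodℤ-map-* f g is)) (interchange (f i) (g i) _ _)
  where
  interchange : ∀ a b c d → a *ᶻ b *ᶻ (c *ᶻ d) ≡ a *ᶻ c *ᶻ (b *ᶻ d)
  interchange = solve-∀

ψ≡γ∂χ : ∀ t is g h → ψ t is g h ≡ γ∂ t (χ is) g h
ψ≡γ∂χ t is g h = cong (γ t g h *ᶻ_) (begin
  prodℤ (map (λ i → δ i g *ᶻ δ i h *ᶻ δ i gh) is)
    ≡⟨ prodℤ-map-* (λ i → δ i g *ᶻ δ i h) (λ i → δ i gh) is ⟩
  prodℤ (map (λ i → δ i g *ᶻ δ i h) is) *ᶻ χ is gh
    ≡⟨ cong (_*ᶻ χ is gh) (prodℤ-map-* (λ i → δ i g) (λ i → δ i h) is) ⟩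
  χ is g *ᶻ χ is h *ᶻ χ is gh ∎)
  where
  open ≡-Reasoning
  gh = (g + h) % N t

rowSum-ψ : ∀ t is g → rowSum t (ψ t is) g ≡ rowSum t (γ∂ t (χ is)) g
rowSum-ψ t is g = ∑-cong (N t) (λ h _ → ψ≡γ∂χ t is g h)

2≤∣rowSum-ψ-even∣ : ∀ t is j → j < 2 * t → 2 ≤ ∣ rowSum t (ψ t is) (2 + j * 2) ∣
2≤∣rowSum-ψ-even∣ t is j j<2t = ≡₄2⇒2≤∣∣ (begin
  rowSum t (ψ t is) g              ≡⟨ rowSum-ψ t is g ⟩
  rowSum t (γ∂ t (χ is)) g         ≈⟨ rowSum-γ∂-≡₄ t (χ is) g (χ-isSign is) g≤N ⟩
  + 2 +ᶻ + 2 *ᶻ + g                ≡⟨ cong (λ x → + 2 +ᶻ + 2 *ᶻ x) +g≡2+2j ⟩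
  + 2 +ᶻ + 2 *ᶻ (+ 2 +ᶻ + j *ᶻ + 2) ≡⟨ 2+2[2+2j]≡2+4[1+j] (+ j) ⟩
  + 2 +ᶻ + 4 *ᶻ (+ 1 +ᶻ + j)       ≈⟨ ≡₄-+4* (+ 2) (+ 1 +ᶻ + j) ⟩
  + 2                              ∎)
  where
  open import Relation.Binary.Reasoning.Setoid ≡₄-setoid
  g = 2 + j * 2
  +g≡2+2j : + g ≡ + 2 +ᶻ + j *ᶻ + 2
  +g≡2+2j = trans (ℤ.pos-+ 2 (j * 2)) (cong (+ 2 +ᶻ_) (ℤ.pos-* j 2))
  g≤N : g ≤ N t
  g≤N = s≤s (s≤s (subst (j * 2 ≤_) (trans (ℕ.*-comm (2 * t) 2) (sym (ℕ.*-assoc 2 2 t)))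
                                     (ℕ.*-monoˡ-≤ 2 (ℕ.<⇒≤ j<2t))))
  2+2[2+2j]≡2+4[1+j] : ∀ j → + 2 +ᶻ + 2 *ᶻ (+ 2 +ᶻ j *ᶻ + 2) ≡ + 2 +ᶻ + 4 *ᶻ (+ 1 +ᶻ j)
  2+2[2+2j]≡2+4[1+j] = solve-∀

4*-cancel-≤ : ∀ {m n} → + 4 *ᶻ + m ≤ᶻ + 4 *ᶻ + n → m ≤ n
4*-cancel-≤ {m} {n} 4m≤4n =
  ℕ.*-cancelˡ-≤ 4 (ℤ.drop‿+≤+ (subst₂ _≤ᶻ_ (sym (ℤ.pos-* 4 m)) (sym (ℤ.pos-* 4 n)) 4m≤4n))

χ-sign-changes≡4t : ∀ t is → ∑[ h < suc (4 * t) ] (χ is h *ᶻ χ is (suc h)) ≡ + 1 →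
  ∑[ h < suc (4 * t) ] (+ 1 -ᶻ χ is h *ᶻ χ is (suc h)) ≡ + 4 *ᶻ + t
χ-sign-changes≡4t t is P≡1 =
  trans (∑[1-f] (suc (4 * t)) (λ h → χ is h *ᶻ χ is (suc h)))
        (trans (cong (λ x → + (suc (4 * t)) -ᶻ x) P≡1) (ℤ.pos-* 4 t))

χ-negatives≡2w : ∀ t is → Unique is → All (λ i → 2 ≤ i × i ≤ 4 * t + 1) is →
  ∑[ h < N t ] (+ 1 -ᶻ χ is h) ≡ + 2 *ᶻ + length is
χ-negatives≡2w t is unique bounds =
  ∑[1-χ]≡2*length (N t) is unique
    (All.map (λ (2≤i , i≤4t+1) → ℕ.≤-trans (s≤s z≤n) 2≤i , ℕ.≤-trans i≤4t+1 4t+1≤N) bounds)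
  where
  4t+1≤N : 4 * t + 1 ≤ N t
  4t+1≤N = subst (_≤ N t) (ℕ.+-comm 1 (4 * t)) (ℕ.n≤1+n (suc (4 * t)))

length-lower-bound : ∀ t is → Unique is → All (λ i → 2 ≤ i × i ≤ 4 * t + 1) is →
  ∑[ h < suc (4 * t) ] (χ is h *ᶻ χ is (suc h)) ≡ + 1 → t ≤ length is
length-lower-bound t is unique bounds P≡1 = 4*-cancel-≤ (begin
  + 4 *ᶻ + t                                            ≡⟨ χ-sign-changes≡4t t is P≡1 ⟨
  ∑[ h < suc (4 * t) ] (+ 1 -ᶻ χ is h *ᶻ χ is (suc h))  ≤⟨ sign-changes≤2*negatives (suc (4 * t)) (χ-isSign is)
                                                              (χ₀≡1 t is bounds) (χ[4t+1]≡1 t is bounds) ⟩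
  + 2 *ᶻ ∑[ h < N t ] (+ 1 -ᶻ χ is h)                   ≡⟨ cong (+ 2 *ᶻ_) (χ-negatives≡2w t is unique bounds) ⟩
  + 2 *ᶻ (+ 2 *ᶻ + length is)                           ≡⟨ ℤ.*-assoc (+ 2) (+ 2) (+ length is) ⟨
  + 4 *ᶻ + length is                                    ∎)
  where open ℤ.≤-Reasoning

length-upper-bound : ∀ t is → Unique is → All (λ i → 2 ≤ i × i ≤ 4 * t + 1) is →
  ∑[ h < suc (4 * t) ] (χ is h *ᶻ χ is (suc h)) ≡ + 1 → length is ≤ 3 * t + 1
length-upper-bound t is unique bounds P≡1 = 4*-cancel-≤ (begin
  + 4 *ᶻ W                                             ≡⟨ shift (+ 4 *ᶻ W) (+ 4 *ᶻ + t) ⟩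
  + 4 *ᶻ + t +ᶻ + 4 +ᶻ (+ 4 *ᶻ W -ᶻ + 4 *ᶻ + t -ᶻ + 4)  ≤⟨ ℤ.+-monoˡ-≤ _ 4t+4≤2*positives ⟩
  + 2 *ᶻ positives +ᶻ (+ 4 *ᶻ W -ᶻ + 4 *ᶻ + t -ᶻ + 4)
    ≡⟨ cong (λ x → + 2 *ᶻ x +ᶻ (+ 4 *ᶻ W -ᶻ + 4 *ᶻ + t -ᶻ + 4)) positives≡2N-2w ⟩
  + 2 *ᶻ (+ N t *ᶻ + 2 -ᶻ + 2 *ᶻ W) +ᶻ (+ 4 *ᶻ W -ᶻ + 4 *ᶻ + t -ᶻ + 4)
    ≡⟨ cong (λ x → + 2 *ᶻ (x *ᶻ + 2 -ᶻ + 2 *ᶻ W) +ᶻ (+ 4 *ᶻ W -ᶻ + 4 *ᶻ + t -ᶻ + 4)) (+N≡2+4t t) ⟩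
  + 2 *ᶻ ((+ 2 +ᶻ + 4 *ᶻ + t) *ᶻ + 2 -ᶻ + 2 *ᶻ W) +ᶻ (+ 4 *ᶻ W -ᶻ + 4 *ᶻ + t -ᶻ + 4)
    ≡⟨ simplify (+ t) W ⟩
  + 4 *ᶻ (+ 3 *ᶻ + t +ᶻ + 1)
    ≡⟨ cong (+ 4 *ᶻ_) (trans (ℤ.pos-+ (3 * t) 1) (cong (_+ᶻ + 1) (ℤ.pos-* 3 t))) ⟨
  + 4 *ᶻ + (3 * t + 1)                                 ∎)
  where
  open ℤ.≤-Reasoning
  W = + length is
  positives = ∑[ h < N t ] (+ 1 +ᶻ χ is h)
  positives≡2N-2w : positives ≡ + N t *ᶻ + 2 -ᶻ + 2 *ᶻ W
  positives≡2N-2w = trans (x≡[x+y]-y positives _)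
    (cong₂ _-ᶻ_ (∑[1+f]+∑[1-f] (N t) (χ is)) (χ-negatives≡2w t is unique bounds))
    where
    x≡[x+y]-y : ∀ x y → x ≡ x +ᶻ y -ᶻ y
    x≡[x+y]-y = solve-∀
  4t+4≤2*positives : + 4 *ᶻ + t +ᶻ + 4 ≤ᶻ + 2 *ᶻ positives
  4t+4≤2*positives = subst (λ x → x +ᶻ + 4 ≤ᶻ + 2 *ᶻ positives) (χ-sign-changes≡4t t is P≡1)
    (sign-changes+4≤2*positives (suc (4 * t)) (χ-isSign is) (χ₀≡1 t is bounds) (χ[4t+1]≡1 t is bounds))
  shift : ∀ x c → x ≡ c +ᶻ + 4 +ᶻ (x -ᶻ c -ᶻ + 4)
  shift = solve-∀
  simplify : ∀ t w → + 2 *ᶻ ((+ 2 +ᶻ + 4 *ᶻ t) *ᶻ + 2 -ᶻ + 2 *ᶻ w) +ᶻ (+ 4 *ᶻ w -ᶻ + 4 *ᶻ t -ᶻ + 4)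
                       ≡ + 4 *ᶻ (+ 3 *ᶻ t +ᶻ + 1)
  simplify = solve-∀

corollary2 : (t : ℕ) → 1 ≤ t → (is : List ℕ) → Unique is →
    All (λ i → 2 ≤ i × i ≤ 4 * t + 1) is →
    QuasiOrthogonal t (ψ t is) →
    t ≤ length is × length is ≤ 3 * t + 1
corollary2 t _ is unique bounds quasiOrthogonal =
  length-lower-bound t is unique bounds P≡1 , length-upper-bound t is unique bounds P≡1
  where
  a = χ is
  P = ∑[ h < suc (4 * t) ] (a h *ᶻ a (suc h))
  a₁[P-1]≡0 : a 1 *ᶻ (P -ᶻ + 1) ≡ + 0
  a₁[P-1]≡0 = begin
    a 1 *ᶻ (P -ᶻ + 1)          ≡⟨ rowSum-γ∂-one t a (χ₀≡1 t is bounds) (χ[4t+1]≡1 t is bounds) ⟨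
    rowSum t (γ∂ t a) 1        ≡⟨ rowSum-ψ t is 1 ⟨
    rowSum t (ψ t is) 1        ≡⟨ quasiOrthogonal⇒rowSum₁≡0 t (ψ t is) quasiOrthogonal (2≤∣rowSum-ψ-even∣ t is) ⟩
    + 0                        ∎
    where open ≡-Reasoning
  P≡1 : P ≡ + 1
  P≡1 = ℤ.i-j≡0⇒i≡j P (+ 1) (sign*x≡0⇒x≡0 (P -ᶻ + 1) (χ-isSign is 1) a₁[P-1]≡0)
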